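{- Let $\delta$ be a denial constraint over a schema $\mathcal{S}$ that uses no inequality atoms, $D$ an $\mathcal{S}$-database, $E,E'$ equivalence relations on $\mathsf{Obj}(D)$ and $V,V'$ equivalence relations on $\mathsf{Cells}(D)$. If $D_{E,V}\not\models\delta$ and $E\cup V\subseteq E'\cup V'$, then $D_{E',V'}\not\models\delta$.
   Context: Constants come from three pairwise disjoint infinite sets: objects $\mathsf{O}$, values $\mathsf{V}$, and tuple identifiers (tids) $\mathsf{TID}$. A schema $\mathcal{S}$ is a finite set of relation symbols $R$, each with an arity $k$ and a type vector in $\{\mathsf{O},\mathsf{V}\}^k$. An $\mathcal{S}$-database $D$ is a finite set of facts $R(t,c_1,\dots,c_k)$ with $R/k\in\mathcal{S}$, $t\in\mathsf{TID}$, $c_i\in\mathbf{type}(R,i)$, each tid occurring in at most one fact; $t[i]$ is the constant at position $i$ of the fact with tid $t$. $\mathsf{Obj}(D)$ is the set of objects occurring in $D$, $\mathsf{Dom}(D)$ the set of constants occurring in $D$, and $\mathsf{Cells}(D)=\{\langle t,i\rangle\mid R(t,c_1,\dots,c_k)\in D,\ \mathbf{type}(R,i)=\mathsf{V}\}$. A denial constraint has the form $\exists\vec y.\varphi(\vec y)\to\bot$ where $\varphi$ is a conjunction of relational atoms $R(u_0,u_1,\dots,u_k)$ ($u_0$ in the tid position, terms constants or variables), possibly with inequality atoms (excluded here). Induced database: for an equivalence relation $E$ on $\mathsf{Obj}(D)$ and $V$ on $\mathsf{Cells}(D)$, $D_{E,V}$ is obtained from $D$ by replacing each tid $t$ by $\{t\}$,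 each occurrence of an object $o$ by $\{o'\mid(o,o')\in E\}$, and the value in each cell $\langle t,i\rangle$ by $\{t'[i']\mid(\langle t,i\rangle,\langle t',i'\rangle)\in V\}$. A Boolean query $q$ is satisfied in $D_{E,V}$ if there are $h:\mathrm{vars}(q)\cup\mathrm{cons}(q)\to 2^{\mathsf{Dom}(D)}\setminus\{\emptyset\}$ and, for each $k$-ary relational atom $\pi$ of $q$, $g_\pi:\{0,\dots,k\}\to 2^{\mathsf{Dom}(D)}$ such that: (1) $h(a)=\{a\}$ for constants $a$, and for each variable $z$, $h(z)$ is the intersection of all $g_\pi(i)$ with $z$ the $i$-th argument of $\pi$; (2) for each relational atom $\pi=R(u_0,\dots,u_k)$, $R(g_\pi(0),\dots,g_\pi(k))\in D_{E,V}$, and $u_i\in g_\pi(i)$ whenever $u_i$ is a constant. $D_{E,V}\models\exists\vec y.\varphi(\vec y)\to\bot$ iff $D_{E,V}\not\models\exists\vec y.\varphi(\vec y)$. -}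

module Defs where

open import Data.Nat using (ℕ; zero; suc)
open import Data.Product using (Σ; ∃; _×_; _,_; proj₁)
open import Data.Sum using (_⊎_; inj₁; inj₂)
open import Data.Empty using (⊥)
open import Data.Maybe using (Maybe; just; nothing)
open import Data.List using (List; length; lookup)
open import Data.List.Membership.Propositional using (_∈_)
open import Data.List.Relation.Unary.All using (All)
open import Data.List.Relation.Unary.AllPairs using (AllPairs)
open import Data.List.Relation.Binary.Pointwise using (Pointwise)
open import Data.Fin using (Fin)
open import Relation.Binary.PropositionalEquality using (_≡_; _≢_)
open import Function.Bundles using (_⇔_)

data Const : Set where
  obj  : ℕ → Const
  val  : ℕ → Const
  tidc : ℕ → Const

data Ty : Set where
  O  : Ty
  Vt : Ty

data HasType : Const → Ty → Set where
  obj-O  : ∀ {o} → HasType (obj o) O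
  val-V  : ∀ {v} → HasType (val v) Vt

_‼_ : {A : Set} → List A → ℕ → Maybe A
List.[] ‼ _ = nothing
(x List.∷ xs) ‼ zero = just x
(x List.∷ xs) ‼ suc i = xs ‼ i

record Schema : Set where
  field
    syms   : List (ℕ × List Ty)
    unique : AllPairs (λ p q → proj₁ p ≢ proj₁ q) syms
open Schema public

-- Type of relation R at position i (positions 1..k; position 0 is the tid).
typeAt : List Ty → ℕ → Maybe Ty
typeAt tys zero    = nothing
typeAt tys (suc i) = tys ‼ i

record Fact : Set where
  constructor fact
  field
    rel  : ℕ
    tid  : ℕ
    args : List Const
open Fact public

-- t[i]: constant at position i (0 = tid position, 1..k = arguments).
posVal : Fact → ℕ → Maybe Const
posVal f zero    = just (tidc (tid f))
posVal f (suc i) = args f ‼ i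

WellTyped : Schema → Fact → Set
WellTyped S f = ∃ λ tys → (rel f , tys) ∈ syms S × Pointwise HasType (args f) tys

IsDatabase : Schema → List Fact → Set
IsDatabase S D =
  All (WellTyped S) D ×
  (∀ {f f'} → f ∈ D → f' ∈ D → tid f ≡ tid f' → f ≡ f')

Obj : List Fact → ℕ → Set
Obj D o = ∃ λ f → f ∈ D × obj o ∈ args f

Dom : List Fact → Const → Set
Dom D c = ∃ λ f → f ∈ D × (c ≡ tidc (tid f) ⊎ c ∈ args f)

-- Cells ⟨t,i⟩ (i a 1-based argument position).
Cell : Set
Cell = ℕ × ℕ

Cells : Schema → List Fact → Cell → Set
Cells S D (t , i) = ∃ λ f → f ∈ D × tid f ≡ t ×
  ∃ λ tys → (rel f , tys) ∈ syms S × typeAt tys i ≡ just Vt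

ValAt : List Fact → ℕ → ℕ → Const → Set
ValAt D t i c = ∃ λ f → f ∈ D × tid f ≡ t × posVal f i ≡ just c

record IsEquivOn {X : Set} (A : X → Set) (R : X → X → Set) : Set where
  field
    carrier : ∀ {x y} → R x y → A x × A y
    refl    : ∀ {x} → A x → R x x
    sym     : ∀ {x y} → R x y → R y x
    trans   : ∀ {x y z} → R x y → R y z → R x z

-- E ∪ V as a relation on Obj ⊎ Cells (the carriers are disjoint).
_∪ᴿ_ : (ℕ → ℕ → Set) → (Cell → Cell → Set) → (ℕ ⊎ Cell) → (ℕ ⊎ Cell) → Set
(E ∪ᴿ V) (inj₁ o) (inj₁ o') = E o o'
(E ∪ᴿ V) (inj₂ c) (inj₂ c') = V c c'
(E ∪ᴿ V) _        _         = ⊥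

_⊆ᴿ_ : {X : Set} → (X → X → Set) → (X → X → Set) → Set
R ⊆ᴿ R' = ∀ x y → R x y → R' x y

-- The induced database D_{E,V}: entries are sets of constants (predicates).

CSet : Set₁
CSet = Const → Set

replace : List Fact → (ℕ → ℕ → Set) → (Cell → Cell → Set) → ℕ → ℕ → Maybe Const → CSet
replace D E V t i (just (obj o))  c = ∃ λ o' → E o o' × c ≡ obj o'
replace D E V t i (just (val _))  c = ∃ λ t' → ∃ λ i' → V (t , i) (t' , i') × ValAt D t' i' c
replace D E V t i (just (tidc t₀)) c = c ≡ tidc t₀
replace D E V t i nothing         c = ⊥

induced : List Fact → (ℕ → ℕ → Set) → (Cell → Cell → Set) → Fact → ℕ → CSet
induced D E V f zero    c = c ≡ tidc (tid f)
induced D E V f (suc i) c = replace D E V (tid f) (suc i) (args f ‼ i) c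

-- R(G(0), …, G(k)) ∈ D_{E,V}  (set entries compared extensionally)
InInduced : List Fact → (ℕ → ℕ → Set) → (Cell → Cell → Set) → ℕ → ℕ → (ℕ → CSet) → Set
InInduced D E V R k G = ∃ λ f → f ∈ D × rel f ≡ R × length (args f) ≡ k ×
  (∀ i → i Data.Nat.≤ k → ∀ c → G i c ⇔ induced D E V f i c)

-- Queries: conjunctions of relational atoms R(u₀, u₁, …, u_k)
-- (no inequality atoms).

data Term : Set where
  var : ℕ → Term
  con : Const → Term

record Atom : Set where
  constructor atom
  field
    arel : ℕ
    u₀   : Term
    us   : List Term
open Atom public

termAt : Atom → ℕ → Maybe Term
termAt a zero    = just (u₀ a)
termAt a (suc i) = us a ‼ i

Query : Set
Query = List Atom

OccursIn : Query → ℕ → Set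
OccursIn q z = ∃ λ (j : Fin (length q)) → ∃ λ i → termAt (lookup q j) i ≡ just (var z)

-- D_{E,V} ⊨ ∃ȳ.φ  (h only on variables; h(a) = {a} for constants is
-- forced and plays no role)
Satisfied : List Fact → (ℕ → ℕ → Set) → (Cell → Cell → Set) → Query → Set₁
Satisfied D E V q =
  Σ (ℕ → CSet) λ h →
  Σ (Fin (length q) → ℕ → CSet) λ g →
    (∀ z → OccursIn q z →
        (∃ λ c → h z c) ×
        (∀ c → h z c → Dom D c) ×
        (∀ c → h z c ⇔ (∀ j i → termAt (lookup q j) i ≡ just (var z) → g j i c)))
    ×
    (∀ j → InInduced D E V (arel (lookup q j)) (length (us (lookup q j))) (g j) ×
           (∀ i a → termAt (lookup q j) i ≡ just (con a) → g j i a))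

-- Denial constraint ∃ȳ.φ(ȳ) → ⊥ over S, with φ a list of relational atoms.
DenialConstraint : Set
DenialConstraint = Query

OverSchema : Schema → DenialConstraint → Set
OverSchema S δ = All (λ a → ∃ λ tys → (arel a , tys) ∈ syms S × length (us a) ≡ length tys) δ

Models : List Fact → (ℕ → ℕ → Set) → (Cell → Cell → Set) → DenialConstraint → Set₁
Models D E V δ = Satisfied D E V δ → ⊥

-- D_{E,V} ⊭ δ, i.e. D_{E,V} ⊨ ∃ȳ.φ(ȳ) (constructive positive reading)
NotModels : List Fact → (ℕ → ℕ → Set) → (Cell → Cell → Set) → DenialConstraint → Set₁
NotModels D E V δ = Satisfied D E V δ

-- Keep every atom of a satisfying assignment for D_{E,V} matched to the
-- same fact of D, but now read that fact in D_{E',V'}. Since E ∪ V ⊆ E' ∪ V', every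
-- entry of the induced fact only grows, so the constants required by the query are
-- still present; each variable is reassigned the intersection of its new entries,
-- which is nonempty because it still contains the old witness. The new entries stay
-- inside Dom D because E' relates objects of D only.
module Submission where

open import Defs
open import Data.Nat using (ℕ; zero; suc; _≤_; _<_; z≤n; s≤s)
open import Data.List using (List; _∷_; length; lookup)
open import Data.List.Membership.Propositional using (_∈_)
open import Data.List.Relation.Unary.Any using (here; there)
open import Data.Fin using (Fin)
open import Data.Maybe using (just; nothing)
open import Data.Product using (∃; _×_; _,_; proj₁; proj₂)
open import Data.Sum using (inj₁; inj₂)
open import Function using (id)
open import Function.Bundles using (_⇔_; mk⇔; Equivalence)
open import Relation.Binary.PropositionalEquality using (_≡_; refl)
open import Relation.Unary using (_⊆_)

‼-< : ∀ {A : Set} (xs : List A) i {x} → xs ‼ i ≡ just x → i < length xs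
‼-< (_ ∷ _)  zero    refl = s≤s z≤n
‼-< (_ ∷ xs) (suc i) eq   = s≤s (‼-< xs i eq)

‼-∈ : ∀ {A : Set} (xs : List A) i {x} → xs ‼ i ≡ just x → x ∈ xs
‼-∈ (_ ∷ _)  zero    refl = here refl
‼-∈ (_ ∷ xs) (suc i) eq   = there (‼-∈ xs i eq)

termAt-≤ : ∀ a i {u} → termAt a i ≡ just u → i ≤ length (us a)
termAt-≤ a zero    _  = z≤n
termAt-≤ a (suc i) eq = ‼-< (us a) i eq

posVal-∈Dom : ∀ {D f} → f ∈ D → ∀ i {c} → posVal f i ≡ just c → Dom D c
posVal-∈Dom f∈D zero    refl = _ , f∈D , inj₁ refl
posVal-∈Dom f∈D (suc i) eq   = _ , f∈D , inj₂ (‼-∈ _ i eq)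

module _ (D : List Fact) {E E' : ℕ → ℕ → Set} {V V' : Cell → Cell → Set}
         (E∪V⊆E'∪V' : (E ∪ᴿ V) ⊆ᴿ (E' ∪ᴿ V')) where

  replace-mono : ∀ t i m → replace D E V t i m ⊆ replace D E' V' t i m
  replace-mono t i (just (obj o)) (o' , oEo' , eq) =
    o' , E∪V⊆E'∪V' (inj₁ o) (inj₁ o') oEo' , eq
  replace-mono t i (just (val _)) (t' , i' , cVc' , at) =
    t' , i' , E∪V⊆E'∪V' (inj₂ _) (inj₂ _) cVc' , at
  replace-mono t i (just (tidc _)) eq = eq

  induced-mono : ∀ f i → induced D E V f i ⊆ induced D E' V' f i
  induced-mono f zero    eq = eq
  induced-mono f (suc i)    = replace-mono (tid f) (suc i) (args f ‼ i)

induced-⊆Dom : ∀ (D : List Fact) {E : ℕ → ℕ → Set} (V : Cell → Cell → Set) →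
               (∀ {o o'} → E o o' → Obj D o') →
               ∀ {f} → f ∈ D → ∀ i → induced D E V f i ⊆ Dom D
induced-⊆Dom D V E⊆Obj f∈D zero    refl = _ , f∈D , inj₁ refl
induced-⊆Dom D V E⊆Obj {f} f∈D (suc i) with args f ‼ i in eq
... | just (obj o)  = λ { (o' , oEo' , refl) →
                          let f' , f'∈D , o'∈ = E⊆Obj oEo' in f' , f'∈D , inj₂ o'∈ }
... | just (val _)  = λ { (_ , i' , _ , f' , f'∈D , _ , at) → posVal-∈Dom f'∈D i' at }
... | just (tidc _) = λ { refl → _ , f∈D , inj₂ (‼-∈ (args f) i eq) }
... | nothing       = λ ()

module _ (D : List Fact) {E E' : ℕ → ℕ → Set} {V V' : Cell → Cell → Set}
         (grows : ∀ f i → induced D E V f i ⊆ induced D E' V' f i)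
         (within-Dom : ∀ {f} → f ∈ D → ∀ i → induced D E' V' f i ⊆ Dom D) where

  private
    variable
      R k : ℕ
      G : ℕ → CSet

  matchedFact : InInduced D E V R k G → Fact
  matchedFact = proj₁

  rematch : (m : InInduced D E V R k G) → InInduced D E' V' R k (induced D E' V' (matchedFact m))
  rematch (f , f∈D , rel≡ , len≡ , _) = f , f∈D , rel≡ , len≡ , λ _ _ _ → mk⇔ id id

  rematch-grows : (m : InInduced D E V R k G) →
                  ∀ i → i ≤ k → G i ⊆ induced D E' V' (matchedFact m) i
  rematch-grows (f , _ , _ , _ , G≡) i i≤k {c} Gc = grows f i (Equivalence.to (G≡ i i≤k c) Gc)

  rematch-⊆Dom : (m : InInduced D E V R k G) → ∀ i → induced D E' V' (matchedFact m) i ⊆ Dom D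
  rematch-⊆Dom (_ , f∈D , _) = within-Dom f∈D

  satisfied-mono : ∀ q → Satisfied D E V q → Satisfied D E' V' q
  satisfied-mono q (h , g , vars-ok , atoms-ok) = h' , g' , vars-ok' , atoms-ok'
    where
    match : ∀ j → InInduced D E V (arel (lookup q j)) (length (us (lookup q j))) (g j)
    match j = proj₁ (atoms-ok j)

    g' : Fin (length q) → ℕ → CSet
    g' j = induced D E' V' (matchedFact (match j))

    OccursAt : ℕ → Fin (length q) → ℕ → Set
    OccursAt z j i = termAt (lookup q j) i ≡ just (var z)

    h' : ℕ → CSet
    h' z c = ∀ j i → OccursAt z j i → g' j i c

    g⊆g' : ∀ j i {u} → termAt (lookup q j) i ≡ just u → g j i ⊆ g' j i
    g⊆g' j i at = rematch-grows (match j) i (termAt-≤ (lookup q j) i at)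

    vars-ok' : ∀ z → OccursIn q z →
               (∃ λ c → h' z c) × (∀ c → h' z c → Dom D c) ×
               (∀ c → h' z c ⇔ (∀ j i → OccursAt z j i → g' j i c))
    vars-ok' z occ@(j₀ , i₀ , at₀) =
      let (c , hzc) , _ , h≡⋂g = vars-ok z occ
      in (c , λ j i at → g⊆g' j i at (Equivalence.to (h≡⋂g c) hzc j i at))
       , (λ _ h'zc → rematch-⊆Dom (match j₀) i₀ (h'zc j₀ i₀ at₀))
       , λ _ → mk⇔ id id

    atoms-ok' : ∀ j → InInduced D E' V' (arel (lookup q j)) (length (us (lookup q j))) (g' j) ×
                      (∀ i a → termAt (lookup q j) i ≡ just (con a) → g' j i a)
    atoms-ok' j = rematch (match j) , λ i a at → g⊆g' j i at (proj₂ (atoms-ok j) i a at)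

lemma4 : (S : Schema) (δ : DenialConstraint) → OverSchema S δ →
         (D : List Fact) → IsDatabase S D →
         (E E' : ℕ → ℕ → Set) (V V' : Cell → Cell → Set) →
         IsEquivOn (Obj D) E → IsEquivOn (Obj D) E' →
         IsEquivOn (Cells S D) V → IsEquivOn (Cells S D) V' →
         NotModels D E V δ → (E ∪ᴿ V) ⊆ᴿ (E' ∪ᴿ V') →
         NotModels D E' V' δ
lemma4 S δ _ D _ E E' V V' _ E'-equiv _ _ D-EV⊭δ E∪V⊆E'∪V' =
  satisfied-mono D (induced-mono D E∪V⊆E'∪V')
    (induced-⊆Dom D V' (λ oE'o' → proj₂ (IsEquivOn.carrier E'-equiv oE'o')))
    δ D-EV⊭δ
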